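{- For all positive integers $m,n$, $$\sum_{k=1}^n (-1)^{k-1}\binom{2n}{n-k} k^{2m} = \frac{(-1)^{n-1}}{2} \sum_{\ell=0}^m \langle 2n\rangle_{2\ell}\binom{\ell}{2n-\ell}\sigma_{m,\ell}(n).$$
   Context: Falling factorial: $\langle x\rangle_0=1$ and $\langle x\rangle_j = x(x-1)\cdots(x-j+1)$ for positive integers $j$. Binomial coefficients $\binom{a}{b}$ with $b>a\ge 0$ integers are $0$. For nonnegative integers $\ell\le m$ and an indeterminate $y$, $\sigma_{m,\ell}(y)$ denotes the coefficient of $T^{m-\ell}$ in the formal power series $\prod_{j=0}^{\ell} \frac{1}{1-T(y-j)^2}$; equivalently $\sigma_{m,\ell}(y)=\sum_{0\le k_1\le\cdots\le k_{m-\ell}\le \ell}\prod_{i=1}^{m-\ell}(y-k_i)^2$. -}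

module Defs where

open import Data.Nat using (ℕ; zero; suc; _∸_) renaming (_+_ to _+ℕ_)
open import Data.Nat.Combinatorics using (_C_)
open import Data.Integer using (ℤ; +_; -[1+_]; _+_; _*_; _-_; -_; _^_)

sumUpTo : ℕ → (ℕ → ℤ) → ℤ
sumUpTo zero    f = + 0
sumUpTo (suc n) f = sumUpTo n f + f n

-- sumFromTo a b f = Σ_{i=a}^{b} f i  (0 when b < a)
sumFromTo : ℕ → ℕ → (ℕ → ℤ) → ℤ
sumFromTo a b f = sumUpTo (suc b ∸ a) (λ i → f (a +ℕ i))

falling : ℤ → ℕ → ℤ
falling x zero    = + 1
falling x (suc j) = falling x j * (x - + j)

-- binomial coefficient with natural top and integer bottom; 0 for negative bottom,
-- and (as in ℕ's _C_) 0 when bottom > top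
binomℤ : ℕ → ℤ → ℤ
binomℤ a (+ b)    = + (a C b)
binomℤ a -[1+ _ ] = + 0

-- hsum y d ℓ = Σ_{0 ≤ k_1 ≤ ... ≤ k_d ≤ ℓ} Π_{i=1}^{d} (y - k_i)^2
-- (recursion on the largest index k_d)
hsum : ℤ → ℕ → ℕ → ℤ
hsum y zero    ℓ = + 1
hsum y (suc d) ℓ = sumFromTo 0 ℓ (λ k → ((y - + k) ^ 2) * hsum y d k)

-- σ_{m,ℓ}(y): coefficient of T^{m-ℓ} in Π_{j=0}^{ℓ} 1/(1 - T (y-j)^2), for ℓ ≤ m
σ : ℕ → ℕ → ℤ → ℤ
σ m ℓ y = hsum y (m ∸ ℓ) ℓ

-- Write D f = Σ_{i=0}^{2n} (-1)^i C(2n,i) f(i). Pairing i = n - k with i = n + k, the left-hand side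
-- equals (-1)^{n-1} D((x - n)^{2m}). Newton interpolation of z^m at the nodes (n - j)^2 gives
-- (x - n)^{2m} = Σ_ℓ σ_{m,ℓ}(n) Π_{j<ℓ} (x - j)(x - 2n + j). The functional D kills every monic product
-- of fewer than 2n linear factors and sends one of exactly 2n factors to (2n)!; the products with ℓ > n
-- vanish at 0, …, 2n. So D of the ℓ-th product is (2n)! for ℓ = n and 0 otherwise, which is
-- ⟨2n⟩_{2ℓ} C(ℓ, 2n - ℓ).
module Submission where

open import Defs
open import Data.Nat using (ℕ; _≤_; _∸_)
open import Data.Nat.Combinatorics using (_C_)
open import Data.Integer using (ℤ; +_; _*_; _-_; -_; _^_)
open import Relation.Binary.PropositionalEquality using (_≡_)

open import Data.Nat as ℕ using (zero; suc; _<_; s≤s)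
import Data.Nat.Properties as ℕ
open import Data.Nat.Combinatorics using (nCk+nC[k+1]≡[n+1]C[k+1]; k>n⇒nCk≡0; nCn≡1; nCk≡nC[n∸k])
open import Data.Integer using (_+_)
open import Data.Sum using (inj₁; inj₂)
import Data.Integer.Properties as ℤ
open import Data.Vec using (Vec; []; _∷_; map)
open import Data.Vec.Membership.Propositional using (_∈_)
open import Data.Vec.Relation.Unary.Any using (here; there)
open import Data.Integer.Tactic.RingSolver using (solve-∀)
open import Relation.Binary.PropositionalEquality using (refl; sym; trans; cong; cong₂; subst; module ≡-Reasoning)
open import Relation.Binary.Definitions using (tri<; tri≈; tri>)
open ≡-Reasoning

sumUpTo-cong : ∀ N {f g : ℕ → ℤ} → (∀ i → i < N → f i ≡ g i) → sumUpTo N f ≡ sumUpTo N g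
sumUpTo-cong zero    f≡g = refl
sumUpTo-cong (suc N) f≡g = cong₂ _+_ (sumUpTo-cong N λ i i<N → f≡g i (ℕ.m<n⇒m<1+n i<N)) (f≡g N ℕ.≤-refl)

sumUpTo-zero : ∀ N {f : ℕ → ℤ} → (∀ i → i < N → f i ≡ + 0) → sumUpTo N f ≡ + 0
sumUpTo-zero zero    f≡0 = refl
sumUpTo-zero (suc N) f≡0 = cong₂ _+_ (sumUpTo-zero N λ i i<N → f≡0 i (ℕ.m<n⇒m<1+n i<N)) (f≡0 N ℕ.≤-refl)

sumUpTo-+ : ∀ N (f g : ℕ → ℤ) → sumUpTo N (λ i → f i + g i) ≡ sumUpTo N f + sumUpTo N g
sumUpTo-+ zero    f g = refl
sumUpTo-+ (suc N) f g = trans (cong (_+ (f N + g N)) (sumUpTo-+ N f g)) (interchange (sumUpTo N f) (sumUpTo N g) (f N) (g N))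
  where
  interchange : ∀ a b c d → (a + b) + (c + d) ≡ (a + c) + (b + d)
  interchange = solve-∀

sumUpTo-* : ∀ N c (f : ℕ → ℤ) → sumUpTo N (λ i → c * f i) ≡ c * sumUpTo N f
sumUpTo-* zero    c f = sym (ℤ.*-zeroʳ c)
sumUpTo-* (suc N) c f = trans (cong (_+ c * f N) (sumUpTo-* N c f)) (sym (ℤ.*-distribˡ-+ c _ (f N)))

sumUpTo-neg : ∀ N (f : ℕ → ℤ) → sumUpTo N (λ i → - f i) ≡ - sumUpTo N f
sumUpTo-neg N f = begin
  sumUpTo N (λ i → - f i)       ≡⟨ sumUpTo-cong N (λ i _ → sym (ℤ.-1*i≡-i (f i))) ⟩
  sumUpTo N (λ i → - + 1 * f i) ≡⟨ sumUpTo-* N (- + 1) f ⟩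
  - + 1 * sumUpTo N f           ≡⟨ ℤ.-1*i≡-i _ ⟩
  - sumUpTo N f                 ∎

sumUpTo-unfoldˡ : ∀ N (f : ℕ → ℤ) → sumUpTo (suc N) f ≡ f 0 + sumUpTo N (λ i → f (suc i))
sumUpTo-unfoldˡ zero    f = ℤ.+-comm (+ 0) (f 0)
sumUpTo-unfoldˡ (suc N) f = trans (cong (_+ f (suc N)) (sumUpTo-unfoldˡ N f)) (ℤ.+-assoc (f 0) _ _)

sumUpTo-++ : ∀ M N (f : ℕ → ℤ) → sumUpTo (M ℕ.+ N) f ≡ sumUpTo M f + sumUpTo N (λ i → f (M ℕ.+ i))
sumUpTo-++ M zero    f = trans (cong (λ k → sumUpTo k f) (ℕ.+-identityʳ M)) (sym (ℤ.+-identityʳ _))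
sumUpTo-++ M (suc N) f = begin
  sumUpTo (M ℕ.+ suc N) f                                     ≡⟨ cong (λ k → sumUpTo k f) (ℕ.+-suc M N) ⟩
  sumUpTo (M ℕ.+ N) f + f (M ℕ.+ N)                           ≡⟨ cong (_+ f (M ℕ.+ N)) (sumUpTo-++ M N f) ⟩
  sumUpTo M f + sumUpTo N (λ i → f (M ℕ.+ i)) + f (M ℕ.+ N)   ≡⟨ ℤ.+-assoc (sumUpTo M f) _ _ ⟩
  sumUpTo M f + sumUpTo (suc N) (λ i → f (M ℕ.+ i))           ∎

sumUpTo-reverse : ∀ N (f : ℕ → ℤ) → sumUpTo N f ≡ sumUpTo N (λ i → f (N ∸ suc i))
sumUpTo-reverse zero    f = refl
sumUpTo-reverse (suc N) f = begin
  sumUpTo N f + f N                           ≡⟨ cong (_+ f N) (sumUpTo-reverse N f) ⟩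
  sumUpTo N (λ i → f (N ∸ suc i)) + f N       ≡⟨ ℤ.+-comm _ (f N) ⟩
  f N + sumUpTo N (λ i → f (N ∸ suc i))       ≡⟨ sumUpTo-unfoldˡ N (λ i → f (suc N ∸ suc i)) ⟨
  sumUpTo (suc N) (λ i → f (suc N ∸ suc i))   ∎

sumUpTo-comm : ∀ M N (f : ℕ → ℕ → ℤ) →
  sumUpTo M (λ i → sumUpTo N (f i)) ≡ sumUpTo N (λ j → sumUpTo M (λ i → f i j))
sumUpTo-comm zero    N f = sym (sumUpTo-zero N (λ _ _ → refl))
sumUpTo-comm (suc M) N f = trans (cong (_+ sumUpTo N (f M)) (sumUpTo-comm M N f)) (sym (sumUpTo-+ N _ _))

sign : ℕ → ℤ
sign i = (- + 1) ^ i

sign-+ : ∀ i j → sign (i ℕ.+ j) ≡ sign i * sign j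
sign-+ = ℤ.^-distribˡ-+-* (- + 1)

sign-*-sign : ∀ i → sign i * sign i ≡ + 1
sign-*-sign zero    = refl
sign-*-sign (suc i) = trans (negate-both (sign i)) (sign-*-sign i)
  where
  negate-both : ∀ s → (- + 1 * s) * (- + 1 * s) ≡ s * s
  negate-both = solve-∀

sign-even : ∀ n → sign (2 ℕ.* n) ≡ + 1
sign-even n = trans (sym (ℤ.^-*-assoc (- + 1) 2 n)) (ℤ.^-zeroˡ n)

-- (-1)^N times the N-th forward difference of f at 0.
altBinomSum : ℕ → (ℤ → ℤ) → ℤ
altBinomSum N f = sumUpTo (suc N) (λ i → sign i * + (N C i) * f (+ i))

shift : (ℤ → ℤ) → ℤ → ℤ
shift f x = f (+ 1 + x)

altBinomSum-cong : ∀ N {f g : ℤ → ℤ} → (∀ x → f x ≡ g x) → altBinomSum N f ≡ altBinomSum N g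
altBinomSum-cong N f≡g = sumUpTo-cong (suc N) λ i _ → cong (sign i * + (N C i) *_) (f≡g (+ i))

altBinomSum-zero : ∀ N {f : ℤ → ℤ} → (∀ i → i ≤ N → f (+ i) ≡ + 0) → altBinomSum N f ≡ + 0
altBinomSum-zero N f≡0 = sumUpTo-zero (suc N) λ i i<1+N →
  trans (cong (sign i * + (N C i) *_) (f≡0 i (ℕ.≤-pred i<1+N))) (ℤ.*-zeroʳ (sign i * + (N C i)))

altBinomSum-linear : ∀ N a b (f g : ℤ → ℤ) →
  altBinomSum N (λ x → a * f x + b * g x) ≡ a * altBinomSum N f + b * altBinomSum N g
altBinomSum-linear N a b f g = begin
  altBinomSum N (λ x → a * f x + b * g x)
    ≡⟨ sumUpTo-cong (suc N) (λ i _ → distrib (sign i * + (N C i)) a b (f (+ i)) (g (+ i))) ⟩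
  sumUpTo (suc N) (λ i → a * (sign i * + (N C i) * f (+ i)) + b * (sign i * + (N C i) * g (+ i)))
    ≡⟨ sumUpTo-+ (suc N) _ _ ⟩
  sumUpTo (suc N) (λ i → a * (sign i * + (N C i) * f (+ i))) + sumUpTo (suc N) (λ i → b * (sign i * + (N C i) * g (+ i)))
    ≡⟨ cong₂ _+_ (sumUpTo-* (suc N) a _) (sumUpTo-* (suc N) b _) ⟩
  a * altBinomSum N f + b * altBinomSum N g ∎
  where
  distrib : ∀ w a b u v → w * (a * u + b * v) ≡ a * (w * u) + b * (w * v)
  distrib = solve-∀

altBinomSum-sum : ∀ N M (c : ℕ → ℤ) (f : ℕ → ℤ → ℤ) →
  altBinomSum N (λ x → sumUpTo M (λ ℓ → c ℓ * f ℓ x)) ≡ sumUpTo M (λ ℓ → c ℓ * altBinomSum N (f ℓ))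
altBinomSum-sum N M c f = begin
  sumUpTo (suc N) (λ i → w i * sumUpTo M (λ ℓ → c ℓ * f ℓ (+ i)))
    ≡⟨ sumUpTo-cong (suc N) (λ i _ → sym (sumUpTo-* M (w i) _)) ⟩
  sumUpTo (suc N) (λ i → sumUpTo M (λ ℓ → w i * (c ℓ * f ℓ (+ i))))
    ≡⟨ sumUpTo-comm (suc N) M _ ⟩
  sumUpTo M (λ ℓ → sumUpTo (suc N) (λ i → w i * (c ℓ * f ℓ (+ i))))
    ≡⟨ sumUpTo-cong M (λ ℓ _ → trans (sumUpTo-cong (suc N) (λ i _ → swap (w i) (c ℓ) (f ℓ (+ i))))
                                      (sumUpTo-* (suc N) (c ℓ) _)) ⟩
  sumUpTo M (λ ℓ → c ℓ * altBinomSum N (f ℓ)) ∎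
  where
  w : ℕ → ℤ
  w i = sign i * + (N C i)
  swap : ∀ w c y → w * (c * y) ≡ c * (w * y)
  swap = solve-∀

altBinomSum-suc : ∀ N f → altBinomSum (suc N) f ≡ altBinomSum N f - altBinomSum N (shift f)
altBinomSum-suc N f = begin
  altBinomSum (suc N) f
    ≡⟨ sumUpTo-unfoldˡ (suc N) _ ⟩
  u 0 + sumUpTo (suc N) (λ i → sign (suc i) * + (suc N C suc i) * f (+ suc i))
    ≡⟨ cong (λ t → u 0 + t) (sumUpTo-cong (suc N) (λ i _ → pascal i)) ⟩
  u 0 + sumUpTo (suc N) (λ i → u (suc i) + - v i)
    ≡⟨ cong (λ t → u 0 + t) (trans (sumUpTo-+ (suc N) (λ i → u (suc i)) (λ i → - v i)) (cong (λ t → sumUpTo (suc N) (λ i → u (suc i)) + t) (sumUpTo-neg (suc N) v))) ⟩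
  u 0 + (sumUpTo (suc N) (λ i → u (suc i)) - altBinomSum N (shift f))
    ≡⟨ sym (ℤ.+-assoc (u 0) _ _) ⟩
  u 0 + sumUpTo (suc N) (λ i → u (suc i)) - altBinomSum N (shift f)
    ≡⟨ cong (_- altBinomSum N (shift f)) (sym (sumUpTo-unfoldˡ (suc N) u)) ⟩
  sumUpTo (suc N) u + u (suc N) - altBinomSum N (shift f)
    ≡⟨ cong (λ t → altBinomSum N f + t - altBinomSum N (shift f)) top-vanishes ⟩
  altBinomSum N f + + 0 - altBinomSum N (shift f)
    ≡⟨ cong (_- altBinomSum N (shift f)) (ℤ.+-identityʳ (altBinomSum N f)) ⟩
  altBinomSum N f - altBinomSum N (shift f) ∎
  where
  u v : ℕ → ℤ
  u i = sign i * + (N C i) * f (+ i)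
  v i = sign i * + (N C i) * shift f (+ i)
  split : ∀ s a b y → - + 1 * s * (a + b) * y ≡ - + 1 * s * b * y + - (s * a * y)
  split = solve-∀
  pascal : ∀ i → sign (suc i) * + (suc N C suc i) * f (+ suc i) ≡ u (suc i) + - v i
  pascal i = begin
    sign (suc i) * + (suc N C suc i) * f (+ suc i)
      ≡⟨ cong (λ c → sign (suc i) * + c * f (+ suc i)) (sym (nCk+nC[k+1]≡[n+1]C[k+1] N i)) ⟩
    sign (suc i) * + (N C i ℕ.+ N C suc i) * f (+ suc i)
      ≡⟨ cong (λ c → sign (suc i) * c * f (+ suc i)) (ℤ.pos-+ (N C i) (N C suc i)) ⟩
    sign (suc i) * (+ (N C i) + + (N C suc i)) * f (+ suc i)
      ≡⟨ split (sign i) (+ (N C i)) (+ (N C suc i)) (f (+ suc i)) ⟩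
    u (suc i) + - v i ∎
  top-vanishes : u (suc N) ≡ + 0
  top-vanishes = begin
    sign (suc N) * + (N C suc N) * f (+ suc N) ≡⟨ cong (λ c → sign (suc N) * + c * f (+ suc N)) (k>n⇒nCk≡0 (ℕ.n<1+n N)) ⟩
    sign (suc N) * + 0 * f (+ suc N)           ≡⟨ cong (_* f (+ suc N)) (ℤ.*-zeroʳ (sign (suc N))) ⟩
    + 0 * f (+ suc N)                           ≡⟨ ℤ.*-zeroˡ (f (+ suc N)) ⟩
    + 0                                         ∎

altBinomSum-const : ∀ N c → altBinomSum (suc N) (λ _ → c) ≡ + 0
altBinomSum-const N c = trans (altBinomSum-suc N (λ _ → c)) (ℤ.+-inverseʳ (altBinomSum N (λ _ → c)))

private
  altBinomSum-suc-id* : ∀ N g → altBinomSum (suc N) (λ x → x * g x)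
    ≡ altBinomSum N (λ x → x * g x) - altBinomSum N (λ x → x * shift g x) - altBinomSum N (shift g)
  altBinomSum-suc-id* N g = begin
    altBinomSum (suc N) (λ x → x * g x)
      ≡⟨ altBinomSum-suc N (λ x → x * g x) ⟩
    altBinomSum N (λ x → x * g x) - altBinomSum N (λ x → (+ 1 + x) * shift g x)
      ≡⟨ cong (λ t → altBinomSum N (λ x → x * g x) - t) (trans (altBinomSum-cong N (λ x → expand x (shift g x)))
           (altBinomSum-linear N (+ 1) (+ 1) (λ x → x * shift g x) (shift g))) ⟩
    altBinomSum N (λ x → x * g x) - (+ 1 * altBinomSum N (λ x → x * shift g x) + + 1 * altBinomSum N (shift g))
      ≡⟨ collect (altBinomSum N (λ x → x * g x)) (altBinomSum N (λ x → x * shift g x)) (altBinomSum N (shift g)) ⟩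
    altBinomSum N (λ x → x * g x) - altBinomSum N (λ x → x * shift g x) - altBinomSum N (shift g) ∎
    where
    expand : ∀ x y → (+ 1 + x) * y ≡ + 1 * (x * y) + + 1 * y
    expand = solve-∀
    collect : ∀ a b c → a - (+ 1 * b + + 1 * c) ≡ a - b - c
    collect = solve-∀

altBinomSum-id* : ∀ N g → altBinomSum (suc N) (λ x → x * g x) ≡ - + suc N * altBinomSum N (shift g)
altBinomSum-id* zero    g = begin
  altBinomSum 1 (λ x → x * g x)                      ≡⟨ altBinomSum-suc-id* 0 g ⟩
  + 0 - + 0 - altBinomSum 0 (shift g)                ≡⟨ collect (altBinomSum 0 (shift g)) ⟩
  - + 1 * altBinomSum 0 (shift g)                    ∎
  where
  collect : ∀ a → + 0 - + 0 - a ≡ - + 1 * a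
  collect = solve-∀
altBinomSum-id* (suc N) g = begin
  altBinomSum (suc (suc N)) (λ x → x * g x)
    ≡⟨ altBinomSum-suc-id* (suc N) g ⟩
  altBinomSum (suc N) (λ x → x * g x) - altBinomSum (suc N) (λ x → x * shift g x) - altBinomSum (suc N) (shift g)
    ≡⟨ cong₂ (λ a b → a - b - altBinomSum (suc N) (shift g)) (altBinomSum-id* N g) (altBinomSum-id* N (shift g)) ⟩
  - n * A - - n * B - altBinomSum (suc N) (shift g)
    ≡⟨ cong (λ c → - n * A - - n * B - c) (altBinomSum-suc N (shift g)) ⟩
  - n * A - - n * B - (A - B)
    ≡⟨ collect n A B ⟩
  - (+ 1 + n) * (A - B)
    ≡⟨ cong (- (+ 1 + n) *_) (sym (altBinomSum-suc N (shift g))) ⟩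
  - + suc (suc N) * altBinomSum (suc N) (shift g) ∎
  where
  n = + suc N
  A = altBinomSum N (shift g)
  B = altBinomSum N (shift (shift g))
  collect : ∀ n a b → - n * a - - n * b - (a - b) ≡ - (+ 1 + n) * (a - b)
  collect = solve-∀

altBinomSum-root : ∀ N c g →
  altBinomSum (suc N) (λ x → (x - c) * g x) ≡ - + suc N * altBinomSum N (shift g) - c * altBinomSum (suc N) g
altBinomSum-root N c g = begin
  altBinomSum (suc N) (λ x → (x - c) * g x)
    ≡⟨ altBinomSum-cong (suc N) (λ x → expand x c (g x)) ⟩
  altBinomSum (suc N) (λ x → + 1 * (x * g x) + - c * g x)
    ≡⟨ altBinomSum-linear (suc N) (+ 1) (- c) (λ x → x * g x) g ⟩
  + 1 * altBinomSum (suc N) (λ x → x * g x) + - c * altBinomSum (suc N) g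
    ≡⟨ cong (λ t → + 1 * t + - c * altBinomSum (suc N) g) (altBinomSum-id* N g) ⟩
  + 1 * (- + suc N * altBinomSum N (shift g)) + - c * altBinomSum (suc N) g
    ≡⟨ collect (- + suc N * altBinomSum N (shift g)) c (altBinomSum (suc N) g) ⟩
  - + suc N * altBinomSum N (shift g) - c * altBinomSum (suc N) g ∎
  where
  expand : ∀ x c y → (x - c) * y ≡ + 1 * (x * y) + - c * y
  expand = solve-∀
  collect : ∀ a c b → + 1 * a + - c * b ≡ a - c * b
  collect = solve-∀

rootProduct : ∀ {k} → Vec ℤ k → ℤ → ℤ
rootProduct []       x = + 1
rootProduct (r ∷ rs) x = (x - r) * rootProduct rs x

rootProduct-shift : ∀ {k} (rs : Vec ℤ k) x → shift (rootProduct rs) x ≡ rootProduct (map (_- + 1) rs) x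
rootProduct-shift []       x = refl
rootProduct-shift (r ∷ rs) x = cong₂ _*_ (move x r) (rootProduct-shift rs x)
  where
  move : ∀ x r → + 1 + x - r ≡ x - (r - + 1)
  move = solve-∀

rootProduct-root : ∀ {k} {rs : Vec ℤ k} {r} → r ∈ rs → rootProduct rs r ≡ + 0
rootProduct-root {rs = r ∷ rs} (here refl) = trans (cong (_* rootProduct rs r) (ℤ.+-inverseʳ r)) (ℤ.*-zeroˡ (rootProduct rs r))
rootProduct-root {rs = r′ ∷ rs} {r} (there r∈rs) =
  trans (cong ((r - r′) *_) (rootProduct-root r∈rs)) (ℤ.*-zeroʳ (r - r′))

altBinomSum-rootProduct-< : ∀ N {k} (rs : Vec ℤ k) → k < N → altBinomSum N (rootProduct rs) ≡ + 0
altBinomSum-rootProduct-< (suc N) []       _         = altBinomSum-const N (+ 1)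
altBinomSum-rootProduct-< (suc N) (r ∷ rs) (s≤s k<N) = begin
  altBinomSum (suc N) (rootProduct (r ∷ rs))
    ≡⟨ altBinomSum-root N r (rootProduct rs) ⟩
  - + suc N * altBinomSum N (shift (rootProduct rs)) - r * altBinomSum (suc N) (rootProduct rs)
    ≡⟨ cong₂ (λ a b → - + suc N * a - r * b)
         (trans (altBinomSum-cong N (rootProduct-shift rs)) (altBinomSum-rootProduct-< N (map (_- + 1) rs) k<N))
         (altBinomSum-rootProduct-< (suc N) rs (ℕ.m<n⇒m<1+n k<N)) ⟩
  - + suc N * + 0 - r * + 0
    ≡⟨ vanish (+ suc N) r ⟩
  + 0 ∎
  where
  vanish : ∀ a b → - a * + 0 - b * + 0 ≡ + 0
  vanish = solve-∀

falling-suc : ∀ x j → falling (+ 1 + x) (suc j) ≡ (+ 1 + x) * falling x j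
falling-suc x zero    = base x
  where
  base : ∀ x → + 1 * (+ 1 + x - + 0) ≡ (+ 1 + x) * + 1
  base = solve-∀
falling-suc x (suc j) = begin
  falling (+ 1 + x) (suc j) * (+ 1 + x - + suc j) ≡⟨ cong (_* (+ 1 + x - + suc j)) (falling-suc x j) ⟩
  (+ 1 + x) * falling x j * (+ 1 + x - + suc j)   ≡⟨ shift-factor (+ 1 + x) (falling x j) x (+ j) ⟩
  (+ 1 + x) * (falling x j * (x - + j))           ∎
  where
  shift-factor : ∀ a b x j → a * b * (+ 1 + x - (+ 1 + j)) ≡ a * (b * (x - j))
  shift-factor = solve-∀

falling-< : ∀ {i j} → i < j → falling (+ i) j ≡ + 0
falling-< {i} {suc j} (s≤s i≤j) with ℕ.m≤n⇒m<n∨m≡n i≤j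
... | inj₁ i<j  = trans (cong (_* (+ i - + j)) (falling-< i<j)) (ℤ.*-zeroˡ (+ i - + j))
... | inj₂ refl = trans (cong (falling (+ i) i *_) (ℤ.+-inverseʳ (+ i))) (ℤ.*-zeroʳ (falling (+ i) i))

altBinomSum-rootProduct : ∀ N (rs : Vec ℤ N) → altBinomSum N (rootProduct rs) ≡ sign N * falling (+ N) N
altBinomSum-rootProduct zero    []       = refl
altBinomSum-rootProduct (suc N) (r ∷ rs) = begin
  altBinomSum (suc N) (rootProduct (r ∷ rs))
    ≡⟨ altBinomSum-root N r (rootProduct rs) ⟩
  - + suc N * altBinomSum N (shift (rootProduct rs)) - r * altBinomSum (suc N) (rootProduct rs)
    ≡⟨ cong₂ (λ a b → - + suc N * a - r * b)
         (trans (altBinomSum-cong N (rootProduct-shift rs)) (altBinomSum-rootProduct N (map (_- + 1) rs)))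
         (altBinomSum-rootProduct-< (suc N) rs ℕ.≤-refl) ⟩
  - + suc N * (sign N * falling (+ N) N) - r * + 0
    ≡⟨ collect (+ suc N) (sign N) (falling (+ N) N) r ⟩
  - + 1 * sign N * ((+ 1 + + N) * falling (+ N) N)
    ≡⟨ cong (sign (suc N) *_) (sym (falling-suc (+ N) N)) ⟩
  sign (suc N) * falling (+ suc N) (suc N) ∎
  where
  collect : ∀ n s f r → - n * (s * f) - r * + 0 ≡ - + 1 * s * (n * f)
  collect = solve-∀

module Newton (a : ℕ → ℤ) where

  newtonBasis : ℕ → ℤ → ℤ
  newtonBasis zero    z = + 1
  newtonBasis (suc ℓ) z = (z - a ℓ) * newtonBasis ℓ z

  newtonCoeff : ℕ → ℕ → ℤ
  newtonCoeff zero    zero    = + 1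
  newtonCoeff zero    (suc ℓ) = + 0
  newtonCoeff (suc m) zero    = a 0 * newtonCoeff m 0
  newtonCoeff (suc m) (suc ℓ) = newtonCoeff m ℓ + a (suc ℓ) * newtonCoeff m (suc ℓ)

  newtonCoeff-> : ∀ {m ℓ} → m < ℓ → newtonCoeff m ℓ ≡ + 0
  newtonCoeff-> {zero}  {suc ℓ} _         = refl
  newtonCoeff-> {suc m} {suc ℓ} (s≤s m<ℓ) = begin
    newtonCoeff m ℓ + a (suc ℓ) * newtonCoeff m (suc ℓ)
      ≡⟨ cong₂ (λ u v → u + a (suc ℓ) * v) (newtonCoeff-> m<ℓ) (newtonCoeff-> (ℕ.m<n⇒m<1+n m<ℓ)) ⟩
    + 0 + a (suc ℓ) * + 0 ≡⟨ trans (ℤ.+-identityˡ _) (ℤ.*-zeroʳ (a (suc ℓ))) ⟩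
    + 0                   ∎

  newton-expansion : ∀ m z → z ^ m ≡ sumUpTo (suc m) (λ ℓ → newtonCoeff m ℓ * newtonBasis ℓ z)
  newton-expansion zero    z = refl
  newton-expansion (suc m) z = begin
    z * z ^ m
      ≡⟨ cong (z *_) (newton-expansion m z) ⟩
    z * sumUpTo (suc m) (λ ℓ → c ℓ * Q ℓ)
      ≡⟨ sym (sumUpTo-* (suc m) z _) ⟩
    sumUpTo (suc m) (λ ℓ → z * (c ℓ * Q ℓ))
      ≡⟨ sumUpTo-cong (suc m) (λ ℓ _ → split z (a ℓ) (c ℓ) (Q ℓ)) ⟩
    sumUpTo (suc m) (λ ℓ → c ℓ * Q (suc ℓ) + a ℓ * c ℓ * Q ℓ)
      ≡⟨ sumUpTo-+ (suc m) _ _ ⟩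
    S + sumUpTo (suc m) (λ ℓ → a ℓ * c ℓ * Q ℓ)
      ≡⟨ cong (λ t → S + t) (sym (trans (cong (λ t → sumUpTo (suc m) (λ ℓ → a ℓ * c ℓ * Q ℓ) + t) top-vanishes) (ℤ.+-identityʳ _))) ⟩
    S + sumUpTo (suc (suc m)) (λ ℓ → a ℓ * c ℓ * Q ℓ)
      ≡⟨ cong (λ t → S + t) (sumUpTo-unfoldˡ (suc m) (λ ℓ → a ℓ * c ℓ * Q ℓ)) ⟩
    S + (a 0 * c 0 * Q 0 + T)
      ≡⟨ rearrange S (a 0 * c 0 * Q 0) T ⟩
    a 0 * c 0 * Q 0 + (S + T)
      ≡⟨ cong (λ t → a 0 * c 0 * Q 0 + t)
           (trans (sym (sumUpTo-+ (suc m) _ _)) (sumUpTo-cong (suc m) λ ℓ _ → collect (c ℓ) (a (suc ℓ)) (c (suc ℓ)) (Q (suc ℓ)))) ⟩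
    newtonCoeff (suc m) 0 * Q 0 + sumUpTo (suc m) (λ ℓ → newtonCoeff (suc m) (suc ℓ) * Q (suc ℓ))
      ≡⟨ sym (sumUpTo-unfoldˡ (suc m) _) ⟩
    sumUpTo (suc (suc m)) (λ ℓ → newtonCoeff (suc m) ℓ * Q ℓ) ∎
    where
    c : ℕ → ℤ
    c = newtonCoeff m
    Q : ℕ → ℤ
    Q ℓ = newtonBasis ℓ z
    S = sumUpTo (suc m) (λ ℓ → c ℓ * Q (suc ℓ))
    T = sumUpTo (suc m) (λ ℓ → a (suc ℓ) * c (suc ℓ) * Q (suc ℓ))
    split : ∀ z α c q → z * (c * q) ≡ c * ((z - α) * q) + α * c * q
    split = solve-∀
    rearrange : ∀ s x t → s + (x + t) ≡ x + (s + t)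
    rearrange = solve-∀
    collect : ∀ c α d q → c * q + α * d * q ≡ (c + α * d) * q
    collect = solve-∀
    top-vanishes : a (suc m) * c (suc m) * Q (suc m) ≡ + 0
    top-vanishes = trans (cong (λ u → a (suc m) * u * Q (suc m)) (newtonCoeff-> (ℕ.n<1+n m)))
                         (trans (cong (_* Q (suc m)) (ℤ.*-zeroʳ (a (suc m)))) (ℤ.*-zeroˡ (Q (suc m))))

open Newton using (newtonBasis; newtonCoeff; newtonCoeff->; newton-expansion)

squareNodes : ℤ → ℕ → ℤ
squareNodes y k = (y - + k) ^ 2

newtonCoeff-hsum : ∀ y ℓ d → newtonCoeff (squareNodes y) (ℓ ℕ.+ d) ℓ ≡ hsum y d ℓ
newtonCoeff-hsum y zero    zero    = refl
newtonCoeff-hsum y zero    (suc d) =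
  trans (cong (squareNodes y 0 *_) (newtonCoeff-hsum y 0 d)) (sym (ℤ.+-identityˡ _))
newtonCoeff-hsum y (suc ℓ) zero    = begin
  newtonCoeff a (ℓ ℕ.+ 0) ℓ + a (suc ℓ) * newtonCoeff a (ℓ ℕ.+ 0) (suc ℓ)
    ≡⟨ cong₂ (λ u v → u + a (suc ℓ) * v) (newtonCoeff-hsum y ℓ 0) (newtonCoeff-> a (s≤s (ℕ.≤-reflexive (ℕ.+-identityʳ ℓ)))) ⟩
  + 1 + a (suc ℓ) * + 0
    ≡⟨ cong (λ t → + 1 + t) (ℤ.*-zeroʳ (a (suc ℓ))) ⟩
  + 1 ∎
  where
  a = squareNodes y
newtonCoeff-hsum y (suc ℓ) (suc d) = cong₂ (λ u v → u + squareNodes y (suc ℓ) * v)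
  (newtonCoeff-hsum y ℓ (suc d))
  (trans (cong (λ k → newtonCoeff (squareNodes y) k (suc ℓ)) (ℕ.+-suc ℓ d)) (newtonCoeff-hsum y (suc ℓ) d))

σ≡newtonCoeff : ∀ {m ℓ} y → ℓ ≤ m → σ m ℓ y ≡ newtonCoeff (squareNodes y) m ℓ
σ≡newtonCoeff {m} {ℓ} y ℓ≤m = trans (sym (newtonCoeff-hsum y ℓ (m ∸ ℓ)))
  (cong (λ k → newtonCoeff (squareNodes y) k ℓ) (ℕ.m+[n∸m]≡n ℓ≤m))

pairedRoots : ℤ → (ℓ : ℕ) → Vec ℤ (ℓ ℕ.* 2)
pairedRoots t zero    = []
pairedRoots t (suc ℓ) = + ℓ ∷ (t - + ℓ) ∷ pairedRoots t ℓ

∈-pairedRoots : ∀ t {ℓ j} → j < ℓ → + j ∈ pairedRoots t ℓ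
∈-pairedRoots t {suc ℓ} (s≤s j≤ℓ) with ℕ.m≤n⇒m<n∨m≡n j≤ℓ
... | inj₁ j<ℓ  = there (there (∈-pairedRoots t j<ℓ))
... | inj₂ refl = here refl

∈-pairedRoots-mirror : ∀ t {ℓ j} → j < ℓ → t - + j ∈ pairedRoots t ℓ
∈-pairedRoots-mirror t {suc ℓ} (s≤s j≤ℓ) with ℕ.m≤n⇒m<n∨m≡n j≤ℓ
... | inj₁ j<ℓ  = there (there (∈-pairedRoots-mirror t j<ℓ))
... | inj₂ refl = there (here refl)

-- (x − n)² − (n − j)² = (x − j)(x − (2n − j)), so the Newton basis in z = (x − n)² factors over pairedRoots.
newtonBasis-pairedRoots : ∀ n ℓ x →
  newtonBasis (squareNodes (+ n)) ℓ ((x - + n) ^ 2) ≡ rootProduct (pairedRoots (+ (2 ℕ.* n)) ℓ) x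
newtonBasis-pairedRoots n zero    x = refl
newtonBasis-pairedRoots n (suc ℓ) x = begin
  ((x - + n) ^ 2 - (+ n - + ℓ) ^ 2) * newtonBasis (squareNodes (+ n)) ℓ ((x - + n) ^ 2)
    ≡⟨ cong (((x - + n) ^ 2 - (+ n - + ℓ) ^ 2) *_) (newtonBasis-pairedRoots n ℓ x) ⟩
  ((x - + n) ^ 2 - (+ n - + ℓ) ^ 2) * P
    ≡⟨ factor x (+ n) (+ ℓ) P ⟩
  (x - + ℓ) * ((x - (+ n + + n - + ℓ)) * P)
    ≡⟨ cong (λ t → (x - + ℓ) * ((x - (t - + ℓ)) * P)) (sym two-n) ⟩
  (x - + ℓ) * ((x - (+ (2 ℕ.* n) - + ℓ)) * P) ∎
  where
  P = rootProduct (pairedRoots (+ (2 ℕ.* n)) ℓ) x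
  two-n : + (2 ℕ.* n) ≡ + n + + n
  two-n = trans (cong (λ k → + (n ℕ.+ k)) (ℕ.+-identityʳ n)) (ℤ.pos-+ n n)
  factor : ∀ x n l p → ((x - n) * ((x - n) * + 1) - (n - l) * ((n - l) * + 1)) * p ≡ (x - l) * ((x - (n + n - l)) * p)
  factor = solve-∀

pos-∸ : ∀ {a b} → b ≤ a → + a - + b ≡ + (a ∸ b)
pos-∸ {a} {b} b≤a = trans (ℤ.m-n≡m⊖n a b) (ℤ.⊖-≥ b≤a)

2*n∸n≡n : ∀ n → 2 ℕ.* n ∸ n ≡ n
2*n∸n≡n n = trans (ℕ.m+n∸m≡n n (n ℕ.+ 0)) (ℕ.+-identityʳ n)

binomℤ-< : ∀ {n ℓ} → ℓ < n → binomℤ ℓ (+ (2 ℕ.* n) - + ℓ) ≡ + 0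
binomℤ-< {n} {ℓ} ℓ<n = trans (cong (binomℤ ℓ) (pos-∸ (ℕ.≤-trans (ℕ.<⇒≤ ℓ<2n∸ℓ) (ℕ.m∸n≤m (2 ℕ.* n) ℓ))))
                             (cong +_ (k>n⇒nCk≡0 ℓ<2n∸ℓ))
  where
  ℓ<2n∸ℓ : ℓ < 2 ℕ.* n ∸ ℓ
  ℓ<2n∸ℓ = ℕ.m+n≤o⇒m≤o∸n (suc ℓ)
    (ℕ.≤-trans (ℕ.+-mono-≤ ℓ<n (ℕ.<⇒≤ ℓ<n)) (ℕ.≤-reflexive (cong (n ℕ.+_) (sym (ℕ.+-identityʳ n)))))

binomℤ-diagonal : ∀ n → binomℤ n (+ (2 ℕ.* n) - + n) ≡ + 1
binomℤ-diagonal n = begin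
  binomℤ n (+ (2 ℕ.* n) - + n) ≡⟨ cong (binomℤ n) (pos-∸ (ℕ.m≤m+n n (n ℕ.+ 0))) ⟩
  + (n C (2 ℕ.* n ∸ n))        ≡⟨ cong (λ k → + (n C k)) (2*n∸n≡n n) ⟩
  + (n C n)                    ≡⟨ cong +_ (nCn≡1 n) ⟩
  + 1                          ∎

altBinomSum-pairedRoots-< : ∀ {n ℓ} → ℓ < n → altBinomSum (2 ℕ.* n) (rootProduct (pairedRoots (+ (2 ℕ.* n)) ℓ)) ≡ + 0
altBinomSum-pairedRoots-< {n} {ℓ} ℓ<n = altBinomSum-rootProduct-< (2 ℕ.* n) (pairedRoots (+ (2 ℕ.* n)) ℓ)
  (ℕ.<-≤-trans (ℕ.*-monoˡ-< 2 ℓ<n) (ℕ.≤-reflexive (ℕ.*-comm n 2)))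

altBinomSum-pairedRoots-diagonal : ∀ n →
  altBinomSum (2 ℕ.* n) (rootProduct (pairedRoots (+ (2 ℕ.* n)) n)) ≡ falling (+ (2 ℕ.* n)) (2 ℕ.* n)
altBinomSum-pairedRoots-diagonal n = begin
  altBinomSum (2 ℕ.* n) (rootProduct (pairedRoots (+ (2 ℕ.* n)) n))
    ≡⟨ cong (λ k → altBinomSum k (rootProduct (pairedRoots (+ k) n))) (ℕ.*-comm 2 n) ⟩
  altBinomSum (n ℕ.* 2) (rootProduct (pairedRoots (+ (n ℕ.* 2)) n))
    ≡⟨ altBinomSum-rootProduct (n ℕ.* 2) (pairedRoots (+ (n ℕ.* 2)) n) ⟩
  sign (n ℕ.* 2) * falling (+ (n ℕ.* 2)) (n ℕ.* 2)
    ≡⟨ cong (λ k → sign k * falling (+ k) k) (ℕ.*-comm n 2) ⟩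
  sign (2 ℕ.* n) * falling (+ (2 ℕ.* n)) (2 ℕ.* n)
    ≡⟨ trans (cong (_* falling (+ (2 ℕ.* n)) (2 ℕ.* n)) (sign-even n)) (ℤ.*-identityˡ _) ⟩
  falling (+ (2 ℕ.* n)) (2 ℕ.* n) ∎

-- Every point 0, …, 2n is a root j or 2n − j of the ℓ-th paired product with j ≤ n < ℓ.
altBinomSum-pairedRoots-> : ∀ {n ℓ} → n < ℓ → altBinomSum (2 ℕ.* n) (rootProduct (pairedRoots (+ (2 ℕ.* n)) ℓ)) ≡ + 0
altBinomSum-pairedRoots-> {n} {ℓ} n<ℓ =
  altBinomSum-zero (2 ℕ.* n) {rootProduct (pairedRoots (+ (2 ℕ.* n)) ℓ)} (λ i i≤2n → rootProduct-root (root i i≤2n))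
  where
  root : ∀ i → i ≤ 2 ℕ.* n → + i ∈ pairedRoots (+ (2 ℕ.* n)) ℓ
  root i i≤2n with ℕ.≤-<-connex i n
  ... | inj₁ i≤n = ∈-pairedRoots _ (ℕ.≤-<-trans i≤n n<ℓ)
  ... | inj₂ n<i = subst (_∈ pairedRoots (+ (2 ℕ.* n)) ℓ) mirror (∈-pairedRoots-mirror _ j<ℓ)
    where
    j<ℓ : 2 ℕ.* n ∸ i < ℓ
    j<ℓ = ℕ.≤-<-trans (ℕ.≤-trans (ℕ.∸-monoʳ-≤ (2 ℕ.* n) (ℕ.<⇒≤ n<i)) (ℕ.≤-reflexive (2*n∸n≡n n))) n<ℓ
    mirror : + (2 ℕ.* n) - + (2 ℕ.* n ∸ i) ≡ + i
    mirror = trans (pos-∸ (ℕ.m∸n≤m (2 ℕ.* n) i)) (cong +_ (ℕ.m∸[m∸n]≡n i≤2n))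

altBinomSum-pairedRoots : ∀ n ℓ →
  altBinomSum (2 ℕ.* n) (rootProduct (pairedRoots (+ (2 ℕ.* n)) ℓ))
    ≡ falling (+ (2 ℕ.* n)) (2 ℕ.* ℓ) * binomℤ ℓ (+ (2 ℕ.* n) - + ℓ)
altBinomSum-pairedRoots n ℓ with ℕ.<-cmp ℓ n
... | tri< ℓ<n _ _ = begin
  altBinomSum (2 ℕ.* n) (rootProduct (pairedRoots (+ (2 ℕ.* n)) ℓ)) ≡⟨ altBinomSum-pairedRoots-< ℓ<n ⟩
  + 0                                                               ≡⟨ sym (ℤ.*-zeroʳ (falling (+ (2 ℕ.* n)) (2 ℕ.* ℓ))) ⟩
  falling (+ (2 ℕ.* n)) (2 ℕ.* ℓ) * + 0                             ≡⟨ cong (falling (+ (2 ℕ.* n)) (2 ℕ.* ℓ) *_) (sym (binomℤ-< ℓ<n)) ⟩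
  falling (+ (2 ℕ.* n)) (2 ℕ.* ℓ) * binomℤ ℓ (+ (2 ℕ.* n) - + ℓ)    ∎
... | tri≈ _ refl _ = begin
  altBinomSum (2 ℕ.* n) (rootProduct (pairedRoots (+ (2 ℕ.* n)) n)) ≡⟨ altBinomSum-pairedRoots-diagonal n ⟩
  falling (+ (2 ℕ.* n)) (2 ℕ.* n)                                   ≡⟨ sym (ℤ.*-identityʳ (falling (+ (2 ℕ.* n)) (2 ℕ.* n))) ⟩
  falling (+ (2 ℕ.* n)) (2 ℕ.* n) * + 1                             ≡⟨ cong (falling (+ (2 ℕ.* n)) (2 ℕ.* n) *_) (sym (binomℤ-diagonal n)) ⟩
  falling (+ (2 ℕ.* n)) (2 ℕ.* n) * binomℤ n (+ (2 ℕ.* n) - + n)    ∎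
... | tri> _ _ n<ℓ = begin
  altBinomSum (2 ℕ.* n) (rootProduct (pairedRoots (+ (2 ℕ.* n)) ℓ)) ≡⟨ altBinomSum-pairedRoots-> n<ℓ ⟩
  + 0                                                               ≡⟨ sym (ℤ.*-zeroˡ (binomℤ ℓ (+ (2 ℕ.* n) - + ℓ))) ⟩
  + 0 * binomℤ ℓ (+ (2 ℕ.* n) - + ℓ)                                ≡⟨ cong (_* binomℤ ℓ (+ (2 ℕ.* n) - + ℓ)) (sym (falling-< (ℕ.*-monoʳ-< 2 n<ℓ))) ⟩
  falling (+ (2 ℕ.* n)) (2 ℕ.* ℓ) * binomℤ ℓ (+ (2 ℕ.* n) - + ℓ)    ∎

weight-mirror : ∀ n k → k < n →
  sign (n ℕ.+ suc k) * + ((2 ℕ.* n) C (n ℕ.+ suc k)) ≡ sign (n ∸ suc k) * + ((2 ℕ.* n) C (n ∸ suc k))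
weight-mirror n k k<n = cong₂ (λ s c → s * + c) sign-mirror binomial-mirror
  where
  r = n ∸ suc k
  2n≡n+n : 2 ℕ.* n ≡ n ℕ.+ n
  2n≡n+n = cong (n ℕ.+_) (ℕ.+-identityʳ n)
  sign-mirror : sign (n ℕ.+ suc k) ≡ sign r
  sign-mirror = begin
    sign (n ℕ.+ suc k)                  ≡⟨ cong (λ m → sign (m ℕ.+ suc k)) (sym (ℕ.m∸n+n≡m k<n)) ⟩
    sign (r ℕ.+ suc k ℕ.+ suc k)        ≡⟨ cong sign (ℕ.+-assoc r (suc k) (suc k)) ⟩
    sign (r ℕ.+ (suc k ℕ.+ suc k))      ≡⟨ sign-+ r (suc k ℕ.+ suc k) ⟩
    sign r * sign (suc k ℕ.+ suc k)     ≡⟨ cong (sign r *_) (trans (sign-+ (suc k) (suc k)) (sign-*-sign (suc k))) ⟩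
    sign r * + 1                        ≡⟨ ℤ.*-identityʳ (sign r) ⟩
    sign r                              ∎
  binomial-mirror : (2 ℕ.* n) C (n ℕ.+ suc k) ≡ (2 ℕ.* n) C r
  binomial-mirror = begin
    (2 ℕ.* n) C (n ℕ.+ suc k)
      ≡⟨ nCk≡nC[n∸k] (ℕ.≤-trans (ℕ.+-monoʳ-≤ n k<n) (ℕ.≤-reflexive (sym 2n≡n+n))) ⟩
    (2 ℕ.* n) C (2 ℕ.* n ∸ (n ℕ.+ suc k))
      ≡⟨ cong (λ m → (2 ℕ.* n) C (m ∸ (n ℕ.+ suc k))) 2n≡n+n ⟩
    (2 ℕ.* n) C (n ℕ.+ n ∸ (n ℕ.+ suc k))
      ≡⟨ cong ((2 ℕ.* n) C_) (ℕ.[m+n]∸[m+o]≡n∸o n n (suc k)) ⟩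
    (2 ℕ.* n) C r ∎

centredTerm : ℕ → (ℤ → ℤ) → ℕ → ℤ
centredTerm n h i = sign i * + ((2 ℕ.* n) C i) * h (+ i - + n)

centredTerm-pair : ∀ n (h : ℤ → ℤ) → (∀ y → h (- y) ≡ h y) → ∀ k → k < n →
  centredTerm n h (n ∸ suc k) + centredTerm n h (n ℕ.+ suc k)
    ≡ sign (n ∸ 1) * (+ 2 * (sign k * + ((2 ℕ.* n) C (n ∸ suc k)) * h (+ suc k)))
centredTerm-pair n h h-even k k<n = begin
  W * h (+ r - + n) + sign (n ℕ.+ suc k) * + ((2 ℕ.* n) C (n ℕ.+ suc k)) * h (+ (n ℕ.+ suc k) - + n)
    ≡⟨ cong₂ (λ y v → W * h y + v * h (+ (n ℕ.+ suc k) - + n)) below (weight-mirror n k k<n) ⟩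
  W * h (- + suc k) + W * h (+ (n ℕ.+ suc k) - + n)
    ≡⟨ cong₂ (λ u v → W * u + W * h v) (h-even (+ suc k)) above ⟩
  W * H + W * H
    ≡⟨ sym (trans (cong (_* (W * H + W * H)) (sign-*-sign k)) (ℤ.*-identityˡ _)) ⟩
  sign k * sign k * (W * H + W * H)
    ≡⟨ sym (collect (sign k) (sign r) (+ ((2 ℕ.* n) C r)) H) ⟩
  sign k * sign r * (+ 2 * (sign k * + ((2 ℕ.* n) C r) * H))
    ≡⟨ cong (_* (+ 2 * (sign k * + ((2 ℕ.* n) C r) * H))) (sym sign-n-1) ⟩
  sign (n ∸ 1) * (+ 2 * (sign k * + ((2 ℕ.* n) C r) * H)) ∎
  where
  r = n ∸ suc k
  W = sign r * + ((2 ℕ.* n) C r)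
  H = h (+ suc k)
  below : + r - + n ≡ - + suc k
  below = trans (ℤ.m-n≡m⊖n r n) (trans (ℤ.⊖-≤ (ℕ.m∸n≤m n (suc k))) (cong (λ m → - + m) (ℕ.m∸[m∸n]≡n k<n)))
  above : + (n ℕ.+ suc k) - + n ≡ + suc k
  above = trans (pos-∸ (ℕ.m≤m+n n (suc k))) (cong +_ (ℕ.m+n∸m≡n n (suc k)))
  sign-n-1 : sign (n ∸ 1) ≡ sign k * sign r
  sign-n-1 = trans (cong (λ m → sign (m ∸ 1)) (sym (ℕ.m+[n∸m]≡n k<n))) (sign-+ k r)
  collect : ∀ s t c y → s * t * (+ 2 * (s * c * y)) ≡ s * s * (t * c * y + t * c * y)
  collect = solve-∀

altBinomSum-fold : ∀ n (h : ℤ → ℤ) → (∀ y → h (- y) ≡ h y) → h (+ 0) ≡ + 0 →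
  altBinomSum (2 ℕ.* n) (λ x → h (x - + n))
    ≡ sign (n ∸ 1) * (+ 2 * sumFromTo 1 n (λ k → sign (k ∸ 1) * + ((2 ℕ.* n) C (n ∸ k)) * h (+ k)))
altBinomSum-fold n h h-even h0 = begin
  sumUpTo (suc (2 ℕ.* n)) w
    ≡⟨ cong (λ m → sumUpTo m w) (trans (cong (λ m → suc (n ℕ.+ m)) (ℕ.+-identityʳ n)) (sym (ℕ.+-suc n n))) ⟩
  sumUpTo (n ℕ.+ suc n) w
    ≡⟨ sumUpTo-++ n (suc n) w ⟩
  sumUpTo n w + sumUpTo (suc n) (λ i → w (n ℕ.+ i))
    ≡⟨ cong₂ _+_ (sumUpTo-reverse n w) (sumUpTo-unfoldˡ n (λ i → w (n ℕ.+ i))) ⟩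
  sumUpTo n (λ k → w (n ∸ suc k)) + (w (n ℕ.+ 0) + sumUpTo n (λ k → w (n ℕ.+ suc k)))
    ≡⟨ cong (λ t → sumUpTo n (λ k → w (n ∸ suc k)) + (t + sumUpTo n (λ k → w (n ℕ.+ suc k)))) centre ⟩
  sumUpTo n (λ k → w (n ∸ suc k)) + (+ 0 + sumUpTo n (λ k → w (n ℕ.+ suc k)))
    ≡⟨ cong (λ t → sumUpTo n (λ k → w (n ∸ suc k)) + t) (ℤ.+-identityˡ _) ⟩
  sumUpTo n (λ k → w (n ∸ suc k)) + sumUpTo n (λ k → w (n ℕ.+ suc k))
    ≡⟨ sym (sumUpTo-+ n _ _) ⟩
  sumUpTo n (λ k → w (n ∸ suc k) + w (n ℕ.+ suc k))
    ≡⟨ sumUpTo-cong n (centredTerm-pair n h h-even) ⟩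
  sumUpTo n (λ k → sign (n ∸ 1) * (+ 2 * g (suc k)))
    ≡⟨ trans (sumUpTo-* n (sign (n ∸ 1)) _) (cong (sign (n ∸ 1) *_) (sumUpTo-* n (+ 2) _)) ⟩
  sign (n ∸ 1) * (+ 2 * sumUpTo n (λ k → g (suc k))) ∎
  where
  w : ℕ → ℤ
  w = centredTerm n h
  g : ℕ → ℤ
  g k = sign (k ∸ 1) * + ((2 ℕ.* n) C (n ∸ k)) * h (+ k)
  centre : w (n ℕ.+ 0) ≡ + 0
  centre = trans (cong (λ y → c * h y) (trans (cong (λ m → + m - + n) (ℕ.+-identityʳ n)) (ℤ.+-inverseʳ (+ n))))
                 (trans (cong (c *_) h0) (ℤ.*-zeroʳ c))
    where
    c = sign (n ℕ.+ 0) * + ((2 ℕ.* n) C (n ℕ.+ 0))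

power-newton : ∀ n m x →
  (x - + n) ^ (2 ℕ.* m)
    ≡ sumUpTo (suc m) (λ ℓ → newtonCoeff (squareNodes (+ n)) m ℓ * rootProduct (pairedRoots (+ (2 ℕ.* n)) ℓ) x)
power-newton n m x = begin
  (x - + n) ^ (2 ℕ.* m)
    ≡⟨ sym (ℤ.^-*-assoc (x - + n) 2 m) ⟩
  ((x - + n) ^ 2) ^ m
    ≡⟨ newton-expansion (squareNodes (+ n)) m ((x - + n) ^ 2) ⟩
  sumUpTo (suc m) (λ ℓ → newtonCoeff (squareNodes (+ n)) m ℓ * newtonBasis (squareNodes (+ n)) ℓ ((x - + n) ^ 2))
    ≡⟨ sumUpTo-cong (suc m) (λ ℓ _ → cong (newtonCoeff (squareNodes (+ n)) m ℓ *_) (newtonBasis-pairedRoots n ℓ x)) ⟩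
  sumUpTo (suc m) (λ ℓ → newtonCoeff (squareNodes (+ n)) m ℓ * rootProduct (pairedRoots (+ (2 ℕ.* n)) ℓ) x) ∎

neg-^-even : ∀ m y → (- y) ^ (2 ℕ.* m) ≡ y ^ (2 ℕ.* m)
neg-^-even m y = begin
  (- y) ^ (2 ℕ.* m)     ≡⟨ sym (ℤ.^-*-assoc (- y) 2 m) ⟩
  ((- y) ^ 2) ^ m       ≡⟨ cong (_^ m) (square-neg y) ⟩
  (y ^ 2) ^ m           ≡⟨ ℤ.^-*-assoc y 2 m ⟩
  y ^ (2 ℕ.* m)         ∎
  where
  square-neg : ∀ y → (- y) * ((- y) * + 1) ≡ y * (y * + 1)
  square-neg = solve-∀

-- 1 ≤ m makes 0^{2m} = 0 (the refl given to the fold).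
theorem6 : (m n : ℕ) → 1 ≤ m → 1 ≤ n →
    + 2 * sumFromTo 1 n (λ k → (- + 1) ^ (k ∸ 1) * + ((2 Data.Nat.* n) C (n ∸ k)) * (+ k) ^ (2 Data.Nat.* m))
      ≡ (- + 1) ^ (n ∸ 1) * sumFromTo 0 m (λ ℓ → falling (+ (2 Data.Nat.* n)) (2 Data.Nat.* ℓ) * binomℤ ℓ (+ (2 Data.Nat.* n) - + ℓ) * σ m ℓ (+ n))
theorem6 m@(suc _) n _ _ = begin
  + 2 * L
    ≡⟨ sym (trans (sym (ℤ.*-assoc s s _)) (trans (cong (_* (+ 2 * L)) (sign-*-sign (n ∸ 1))) (ℤ.*-identityˡ _))) ⟩
  s * (s * (+ 2 * L))
    ≡⟨ cong (s *_) (sym (altBinomSum-fold n (_^ (2 ℕ.* m)) (neg-^-even m) refl)) ⟩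
  s * altBinomSum (2 ℕ.* n) (λ x → (x - + n) ^ (2 ℕ.* m))
    ≡⟨ cong (s *_) (trans (altBinomSum-cong (2 ℕ.* n) (power-newton n m)) (altBinomSum-sum (2 ℕ.* n) (suc m) c P)) ⟩
  s * sumUpTo (suc m) (λ ℓ → c ℓ * altBinomSum (2 ℕ.* n) (P ℓ))
    ≡⟨ cong (s *_) (sumUpTo-cong (suc m) term) ⟩
  s * sumFromTo 0 m (λ ℓ → falling (+ (2 ℕ.* n)) (2 ℕ.* ℓ) * binomℤ ℓ (+ (2 ℕ.* n) - + ℓ) * σ m ℓ (+ n)) ∎
  where
  s = sign (n ∸ 1)
  L = sumFromTo 1 n (λ k → sign (k ∸ 1) * + ((2 ℕ.* n) C (n ∸ k)) * (+ k) ^ (2 ℕ.* m))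
  c : ℕ → ℤ
  c = newtonCoeff (squareNodes (+ n)) m
  P : ℕ → ℤ → ℤ
  P ℓ = rootProduct (pairedRoots (+ (2 ℕ.* n)) ℓ)
  term : ∀ ℓ → ℓ < suc m →
    c ℓ * altBinomSum (2 ℕ.* n) (P ℓ) ≡ falling (+ (2 ℕ.* n)) (2 ℕ.* ℓ) * binomℤ ℓ (+ (2 ℕ.* n) - + ℓ) * σ m ℓ (+ n)
  term ℓ ℓ<1+m = trans (cong₂ _*_ (sym (σ≡newtonCoeff (+ n) (ℕ.≤-pred ℓ<1+m))) (altBinomSum-pairedRoots n ℓ))
                       (ℤ.*-comm (σ m ℓ (+ n)) _)
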